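{- For every odd integer $k\ge 3$, $C_4\not\le C_k$.
   Context: All graphs are finite and simple, considered up to isomorphism. An edge-colored graph is a pair $(G,c)$ with $c\colon E(G)\to\mathbb{N}$ an arbitrary map (not necessarily proper); it is colored in $t$ or more colors if $|c(E(G))|\ge t$. A subgraph (not necessarily induced) is rainbow if its edges receive pairwise distinct colors. $(G,c)$ is rainbow $H$-free if $G$ contains no rainbow subgraph isomorphic to $H$. For graphs $H_1,H_2$, write $H_1\le H_2$ if there is a positive integer $t$ such that every rainbow $H_1$-free edge-colored complete graph colored in $t$ or more colors is rainbow $H_2$-free. $C_k$ is the cycle on $k$ vertices. -}

module Defs where

open import Data.Nat using (ℕ; zero; suc; _<_)
open import Data.Nat.DivMod using (_mod_)
open import Data.Fin using (Fin; toℕ)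
open import Data.Product using (Σ; ∃; _×_; _,_; proj₁; proj₂)
open import Relation.Binary.PropositionalEquality using (_≡_; _≢_)
open import Function.Definitions using (Injective)
open import Relation.Nullary using (¬_)

record Graph : Set where
  field
    V : ℕ
    E : ℕ
    ends : Fin E → Fin V × Fin V

-- An edge-coloured complete graph K_n: a symmetric colouring of the pairs
-- of vertices (only the values on pairs of distinct vertices matter).
record ColouredKn : Set where
  field
    n : ℕ
    c : Fin n → Fin n → ℕ
    sym : ∀ i j → c i j ≡ c j i

open ColouredKn

-- (K_n, c) is coloured in t or more colours: there are t edges of K_n
-- with pairwise distinct colours, i.e. |c(E(K_n))| ≥ t.
AtLeastColours : ℕ → ColouredKn → Set
AtLeastColours t K =
  Σ (Fin t → Fin (n K) × Fin (n K)) λ e →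
    (∀ a → proj₁ (e a) ≢ proj₂ (e a)) ×
    Injective _≡_ _≡_ (λ a → c K (proj₁ (e a)) (proj₂ (e a)))

RainbowCopy : Graph → ColouredKn → Set
RainbowCopy H K =
  Σ (Fin (Graph.V H) → Fin (n K)) λ f →
    Injective _≡_ _≡_ f ×
    Injective _≡_ _≡_ (λ a → c K (f (proj₁ (Graph.ends H a))) (f (proj₂ (Graph.ends H a))))

RainbowFree : Graph → ColouredKn → Set
RainbowFree H K = ¬ RainbowCopy H K

_≼_ : Graph → Graph → Set
H₁ ≼ H₂ = ∃ λ t → 0 < t ×
  ((K : ColouredKn) → AtLeastColours t K → RainbowFree H₁ K → RainbowFree H₂ K)

next : ∀ {m} → Fin (suc m) → Fin (suc m)
next {m} i = suc (toℕ i) mod (suc m)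

-- The cycle C_k for k = suc m (vertices 0..m, edges {i, i+1 mod k}).
-- This is the simple cycle C_k when k ≥ 3.
Cycle : (k : ℕ) → Graph
Cycle zero = record { V = 0 ; E = 0 ; ends = λ () }
Cycle (suc m) = record { V = suc m ; E = suc m ; ends = λ i → i , next i }

{-# OPTIONS --safe #-}
module Submission where

-- Colour the edge xy of K_N by 0 if x and y have the same parity and by
-- 1 + min(x, y) otherwise. A 4-cycle either has two same-parity edges, both
-- of colour 0, or alternates in parity, and then both edges at its smallest
-- vertex v have colour 1 + v; so there is no rainbow C_4. For odd k the cycle
-- 0, 1, …, k−1 gets the colours 1, …, k−1 on its path edges and 0 on the
-- closing edge between the even vertices k−1 and 0, so it is rainbow; and the
-- path 0, 1, …, t shows that the colouring uses at least t colours.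

open import Defs
open import Data.Nat using (ℕ; zero; suc; _+_; _≤_; _<_; _%_; _⊓_; s≤s; s≤s⁻¹; parity)
open import Data.Nat.Properties
  using (⊓-sel; ⊓-assoc; ⊓-comm; m≤n⇒m⊓n≡m; n≤1+n; suc-injective; 0≢1+n; 1+n≢n;
         m≤n⇒m<n∨m≡n; m≤m+n; m≤n+m)
open import Data.Nat.DivMod using (m<n⇒m%n≡m; n%n≡0)
open import Data.Parity using (Parity; 0ℙ; 1ℙ; _⁻¹)
open import Data.Parity.Properties using (+-homo-+)
open import Data.Fin using (Fin; toℕ; inject₁; inject≤; #_)
open import Data.Fin.Properties
  using (toℕ-injective; toℕ-inject₁; toℕ-inject≤; inject≤-injective; toℕ-fromℕ<; toℕ<n)
open import Data.Product using (_,_; proj₁; proj₂)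
open import Data.Sum using (inj₁; inj₂)
open import Data.Empty using (⊥-elim)
open import Function.Definitions using (Injective)
open import Relation.Binary.PropositionalEquality
  using (_≡_; _≢_; refl; sym; trans; cong; cong₂; module ≡-Reasoning)
open import Relation.Nullary using (¬_)

data Collision₄ {A : Set} (a b c d : A) : Set where
  ≡₀₁ : a ≡ b → Collision₄ a b c d
  ≡₀₂ : a ≡ c → Collision₄ a b c d
  ≡₀₃ : a ≡ d → Collision₄ a b c d
  ≡₁₂ : b ≡ c → Collision₄ a b c d
  ≡₁₃ : b ≡ d → Collision₄ a b c d
  ≡₂₃ : c ≡ d → Collision₄ a b c d

collision₄-map : ∀ {A B : Set} (g : A → B) {a b c d : A} →
  Collision₄ a b c d → Collision₄ (g a) (g b) (g c) (g d)
collision₄-map g (≡₀₁ e) = ≡₀₁ (cong g e)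
collision₄-map g (≡₀₂ e) = ≡₀₂ (cong g e)
collision₄-map g (≡₀₃ e) = ≡₀₃ (cong g e)
collision₄-map g (≡₁₂ e) = ≡₁₂ (cong g e)
collision₄-map g (≡₁₃ e) = ≡₁₃ (cong g e)
collision₄-map g (≡₂₃ e) = ≡₂₃ (cong g e)

collision₄⇒¬injective : ∀ {A : Set} {f : Fin 4 → A} →
  Collision₄ (f (# 0)) (f (# 1)) (f (# 2)) (f (# 3)) → ¬ Injective _≡_ _≡_ f
collision₄⇒¬injective (≡₀₁ e) f-inj with () ← f-inj e
collision₄⇒¬injective (≡₀₂ e) f-inj with () ← f-inj e
collision₄⇒¬injective (≡₀₃ e) f-inj with () ← f-inj e
collision₄⇒¬injective (≡₁₂ e) f-inj with () ← f-inj e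
collision₄⇒¬injective (≡₁₃ e) f-inj with () ← f-inj e
collision₄⇒¬injective (≡₂₃ e) f-inj with () ← f-inj e

⊓-rotate-pairs : ∀ x₀ x₁ x₂ x₃ → (x₀ ⊓ x₁) ⊓ (x₂ ⊓ x₃) ≡ (x₁ ⊓ x₂) ⊓ (x₃ ⊓ x₀)
⊓-rotate-pairs x₀ x₁ x₂ x₃ = begin
  (x₀ ⊓ x₁) ⊓ (x₂ ⊓ x₃)  ≡⟨ ⊓-assoc x₀ x₁ (x₂ ⊓ x₃) ⟩
  x₀ ⊓ (x₁ ⊓ (x₂ ⊓ x₃))  ≡⟨ cong (x₀ ⊓_) (⊓-assoc x₁ x₂ x₃) ⟨
  x₀ ⊓ ((x₁ ⊓ x₂) ⊓ x₃)  ≡⟨ ⊓-comm x₀ ((x₁ ⊓ x₂) ⊓ x₃) ⟩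
  ((x₁ ⊓ x₂) ⊓ x₃) ⊓ x₀  ≡⟨ ⊓-assoc (x₁ ⊓ x₂) x₃ x₀ ⟩
  (x₁ ⊓ x₂) ⊓ (x₃ ⊓ x₀)  ∎
  where open ≡-Reasoning

-- The minimum μ of x₀, …, x₃ is attained both by one of the sides 01, 23 and
-- by one of the sides 12, 30.
cyclic-⊓-collision : ∀ x₀ x₁ x₂ x₃ →
  Collision₄ (x₀ ⊓ x₁) (x₁ ⊓ x₂) (x₂ ⊓ x₃) (x₃ ⊓ x₀)
cyclic-⊓-collision x₀ x₁ x₂ x₃
  with ⊓-rotate-pairs x₀ x₁ x₂ x₃ | ⊓-sel (x₀ ⊓ x₁) (x₂ ⊓ x₃) | ⊓-sel (x₁ ⊓ x₂) (x₃ ⊓ x₀)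
... | μ≡μ′ | inj₁ μ≡₀₁ | inj₁ μ′≡₁₂ = ≡₀₁ (trans (sym μ≡₀₁) (trans μ≡μ′ μ′≡₁₂))
... | μ≡μ′ | inj₁ μ≡₀₁ | inj₂ μ′≡₃₀ = ≡₀₃ (trans (sym μ≡₀₁) (trans μ≡μ′ μ′≡₃₀))
... | μ≡μ′ | inj₂ μ≡₂₃ | inj₁ μ′≡₁₂ = ≡₁₂ (trans (sym μ′≡₁₂) (trans (sym μ≡μ′) μ≡₂₃))
... | μ≡μ′ | inj₂ μ≡₂₃ | inj₂ μ′≡₃₀ = ≡₂₃ (trans (sym μ≡₂₃) (trans μ≡μ′ μ′≡₃₀))

colour : Parity → Parity → ℕ → ℕ → ℕ
colour 0ℙ 0ℙ x y = 0
colour 1ℙ 1ℙ x y = 0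
colour 0ℙ 1ℙ x y = suc (x ⊓ y)
colour 1ℙ 0ℙ x y = suc (x ⊓ y)

colour-sym : ∀ p q x y → colour p q x y ≡ colour q p y x
colour-sym 0ℙ 0ℙ x y = refl
colour-sym 1ℙ 1ℙ x y = refl
colour-sym 0ℙ 1ℙ x y = cong suc (⊓-comm x y)
colour-sym 1ℙ 0ℙ x y = cong suc (⊓-comm x y)

colour-same : ∀ p x y → colour p p x y ≡ 0
colour-same 0ℙ x y = refl
colour-same 1ℙ x y = refl

colour-opposite : ∀ p x y → colour p (p ⁻¹) x y ≡ suc (x ⊓ y)
colour-opposite 0ℙ x y = refl
colour-opposite 1ℙ x y = refl

colour-square-collision : ∀ p₀ p₁ p₂ p₃ x₀ x₁ x₂ x₃ →
  Collision₄ (colour p₀ p₁ x₀ x₁) (colour p₁ p₂ x₁ x₂) (colour p₂ p₃ x₂ x₃) (colour p₃ p₀ x₃ x₀)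
colour-square-collision 0ℙ 0ℙ 0ℙ 0ℙ _ _ _ _ = ≡₀₁ refl
colour-square-collision 0ℙ 0ℙ 0ℙ 1ℙ _ _ _ _ = ≡₀₁ refl
colour-square-collision 0ℙ 0ℙ 1ℙ 0ℙ _ _ _ _ = ≡₀₃ refl
colour-square-collision 0ℙ 0ℙ 1ℙ 1ℙ _ _ _ _ = ≡₀₂ refl
colour-square-collision 0ℙ 1ℙ 0ℙ 0ℙ _ _ _ _ = ≡₂₃ refl
colour-square-collision 0ℙ 1ℙ 0ℙ 1ℙ x₀ x₁ x₂ x₃ = collision₄-map suc (cyclic-⊓-collision x₀ x₁ x₂ x₃)
colour-square-collision 0ℙ 1ℙ 1ℙ 0ℙ _ _ _ _ = ≡₁₃ refl
colour-square-collision 0ℙ 1ℙ 1ℙ 1ℙ _ _ _ _ = ≡₁₂ refl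
colour-square-collision 1ℙ 0ℙ 0ℙ 0ℙ _ _ _ _ = ≡₁₂ refl
colour-square-collision 1ℙ 0ℙ 0ℙ 1ℙ _ _ _ _ = ≡₁₃ refl
colour-square-collision 1ℙ 0ℙ 1ℙ 0ℙ x₀ x₁ x₂ x₃ = collision₄-map suc (cyclic-⊓-collision x₀ x₁ x₂ x₃)
colour-square-collision 1ℙ 0ℙ 1ℙ 1ℙ _ _ _ _ = ≡₂₃ refl
colour-square-collision 1ℙ 1ℙ 0ℙ 0ℙ _ _ _ _ = ≡₀₂ refl
colour-square-collision 1ℙ 1ℙ 0ℙ 1ℙ _ _ _ _ = ≡₀₃ refl
colour-square-collision 1ℙ 1ℙ 1ℙ 0ℙ _ _ _ _ = ≡₀₁ refl
colour-square-collision 1ℙ 1ℙ 1ℙ 1ℙ _ _ _ _ = ≡₀₁ refl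

χ : ℕ → ℕ → ℕ
χ x y = colour (parity x) (parity y) x y

χ-square-collision : (x : Fin 4 → ℕ) →
  Collision₄ (χ (x (# 0)) (x (# 1))) (χ (x (# 1)) (x (# 2)))
             (χ (x (# 2)) (x (# 3))) (χ (x (# 3)) (x (# 0)))
χ-square-collision x = colour-square-collision
  (parity (x (# 0))) (parity (x (# 1))) (parity (x (# 2))) (parity (x (# 3)))
  (x (# 0)) (x (# 1)) (x (# 2)) (x (# 3))

χ-sameParity : ∀ {x y} → parity x ≡ parity y → χ x y ≡ 0
χ-sameParity {x} {y} same rewrite same = colour-same (parity y) x y

χ-suc : ∀ j → χ j (suc j) ≡ suc j
χ-suc j = begin
  colour (parity j) (parity (suc j)) j (suc j)  ≡⟨ cong (λ q → colour (parity j) q j (suc j)) (+-homo-+ 1 j) ⟩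
  colour (parity j) (parity j ⁻¹) j (suc j)     ≡⟨ colour-opposite (parity j) j (suc j) ⟩
  suc (j ⊓ suc j)                               ≡⟨ cong suc (m≤n⇒m⊓n≡m (n≤1+n j)) ⟩
  suc j                                         ∎
  where open ≡-Reasoning

Kχ : ℕ → ColouredKn
Kχ N = record
  { n = N
  ; c = λ u v → χ (toℕ u) (toℕ v)
  ; sym = λ u v → colour-sym (parity (toℕ u)) (parity (toℕ v)) (toℕ u) (toℕ v)
  }

Kχ-rainbowC₄Free : ∀ N → RainbowFree (Cycle 4) (Kχ N)
Kχ-rainbowC₄Free N (f , _ , rainbow) =
  collision₄⇒¬injective (χ-square-collision (λ a → toℕ (f a))) rainbow

χ-rainbow⇒rainbowCopy : ∀ H {N} → Graph.V H ≤ N →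
  Injective _≡_ _≡_ (λ a → χ (toℕ (proj₁ (Graph.ends H a))) (toℕ (proj₂ (Graph.ends H a)))) →
  RainbowCopy H (Kχ N)
χ-rainbow⇒rainbowCopy H V≤N rainbow =
  embed , (λ {u} {v} → inject≤-injective V≤N V≤N u v) , λ {a} {b} eq →
    rainbow (trans (sym (χ-embed (ends a))) (trans eq (χ-embed (ends b))))
  where
  open Graph H
  embed : Fin V → Fin _
  embed v = inject≤ v V≤N
  χ-embed : ∀ e → χ (toℕ (embed (proj₁ e))) (toℕ (embed (proj₂ e))) ≡ χ (toℕ (proj₁ e)) (toℕ (proj₂ e))
  χ-embed (u , v) = cong₂ χ (toℕ-inject≤ u V≤N) (toℕ-inject≤ v V≤N)

data NextCase {m} (i : Fin (suc m)) : Set where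
  step : toℕ i < m → toℕ (next i) ≡ suc (toℕ i) → NextCase i
  wrap : toℕ i ≡ m → toℕ (next i) ≡ 0 → NextCase i

nextCase : ∀ {m} (i : Fin (suc m)) → NextCase i
nextCase {m} i with m≤n⇒m<n∨m≡n (s≤s⁻¹ (toℕ<n i))
... | inj₁ i<m = step i<m (trans (toℕ-fromℕ< _) (m<n⇒m%n≡m (s≤s i<m)))
... | inj₂ i≡m = wrap i≡m (trans (toℕ-fromℕ< _) (trans (cong (λ j → suc j % suc m) i≡m) (n%n≡0 (suc m))))

next-injective : ∀ {m} → Injective _≡_ _≡_ (next {m})
next-injective {m} {i} {j} eq with nextCase i | nextCase j
... | step _ i+1 | step _ j+1 = toℕ-injective (suc-injective (trans (sym i+1) (trans (cong toℕ eq) j+1)))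
... | step _ i+1 | wrap _ j0  = ⊥-elim (0≢1+n (trans (sym j0) (trans (cong toℕ (sym eq)) i+1)))
... | wrap _ i0  | step _ j+1 = ⊥-elim (0≢1+n (trans (sym i0) (trans (cong toℕ eq) j+1)))
... | wrap i≡m _ | wrap j≡m _ = toℕ-injective (trans i≡m (sym j≡m))

χ-next : ∀ {m} → parity m ≡ 0ℙ → (i : Fin (suc m)) → χ (toℕ i) (toℕ (next i)) ≡ toℕ (next i)
χ-next even i with nextCase i
... | step _ i+1 rewrite i+1 = χ-suc (toℕ i)
... | wrap i≡m i0 rewrite i0 = χ-sameParity (trans (cong parity i≡m) even)

Kχ-rainbowOddCycle : ∀ {m N} → suc m ≤ N → parity m ≡ 0ℙ → RainbowCopy (Cycle (suc m)) (Kχ N)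
Kχ-rainbowOddCycle {m} k≤N even = χ-rainbow⇒rainbowCopy (Cycle (suc m)) k≤N λ {i} {j} eq →
  next-injective (toℕ-injective (trans (sym (χ-next even i)) (trans eq (χ-next even j))))

Path : ℕ → Graph
Path t = record { V = suc t ; E = t ; ends = λ a → inject₁ a , Fin.suc a }

path-loopless : ∀ {t} (a : Fin t) → inject₁ a ≢ Fin.suc a
path-loopless a eq = 1+n≢n (sym (trans (sym (toℕ-inject₁ a)) (cong toℕ eq)))

Kχ-rainbowPath : ∀ {t N} → suc t ≤ N → RainbowCopy (Path t) (Kχ N)
Kχ-rainbowPath {t} t<N = χ-rainbow⇒rainbowCopy (Path t) t<N λ {a} {b} eq →
  toℕ-injective (suc-injective (trans (sym (χ-path a)) (trans eq (χ-path b))))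
  where
  χ-path : (a : Fin t) → χ (toℕ (inject₁ a)) (suc (toℕ a)) ≡ suc (toℕ a)
  χ-path a rewrite toℕ-inject₁ a = χ-suc (toℕ a)

rainbowCopy⇒atLeastColours : ∀ H K → (∀ a → proj₁ (Graph.ends H a) ≢ proj₂ (Graph.ends H a)) →
  RainbowCopy H K → AtLeastColours (Graph.E H) K
rainbowCopy⇒atLeastColours H K loopless (f , f-inj , rainbow) =
  (λ a → f (proj₁ (ends a)) , f (proj₂ (ends a))) , (λ a eq → loopless a (f-inj eq)) , rainbow
  where open Graph H

suc%2≡1⇒parity≡0ℙ : ∀ m → suc m % 2 ≡ 1 → parity m ≡ 0ℙ
suc%2≡1⇒parity≡0ℙ zero          _   = refl
suc%2≡1⇒parity≡0ℙ (suc zero)    ()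
suc%2≡1⇒parity≡0ℙ (suc (suc m)) odd = suc%2≡1⇒parity≡0ℙ m odd

theorem8 : (k : ℕ) → 3 ≤ k → k % 2 ≡ 1 → ¬ (Cycle 4 ≼ Cycle k)
theorem8 zero () _
theorem8 (suc m) _ k-odd (t , _ , C₄≼Cₖ) =
  C₄≼Cₖ (Kχ N)
    (rainbowCopy⇒atLeastColours (Path t) (Kχ N) path-loopless (Kχ-rainbowPath t<N))
    (Kχ-rainbowC₄Free N)
    (Kχ-rainbowOddCycle k≤N (suc%2≡1⇒parity≡0ℙ m k-odd))
  where
  N = suc (t + m)
  t<N : suc t ≤ N
  t<N = s≤s (m≤m+n t m)
  k≤N : suc m ≤ N
  k≤N = s≤s (m≤n+m m t)
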